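{- Let $m \neq \ell$ with $0\le m,\ell\le n-2$. Then $$ \sum_{\pi \in \mathrm{PPF}_n} q^{ \Delta_{\ell} f(\pi)} t^{\Delta_{m} f(\pi)} = (q+t+n-3)^{n-1}.$$
   Context: A parking function of length $n$ is a sequence of positive integers whose increasing rearrangement $\lambda$ satisfies $\lambda_i\le i$; it is prime if removing any instance of 1 yields a parking function of length $n-1$. $\mathrm{PPF}_n$ denotes the set of prime parking functions of length $n$. A tuple $(x_1,\dots,x_n)$ has an $\ell$-forward difference at $i\in[n-1]$ if $x_{i+1}-x_i\equiv\ell\pmod{n-1}$; $\Delta_\ell f(\pi)$ denotes the number of $\ell$-forward differences of $\pi$. -}

module Defs where

open import Data.Bool using (Bool; true; false; _∧_; if_then_else_)
open import Data.Nat using (ℕ; zero; suc; _+_; _∸_; _≤ᵇ_; _≡ᵇ_; _%_)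
open import Data.Nat.Properties using (≤-decTotalOrder)
open import Data.List using (List; []; _∷_; map; concatMap; upTo; foldr; filter; length)
import Data.List.Sort.InsertionSort.Base as ISort
open import Algebra.Bundles using (CommutativeSemiring)
open import Relation.Nullary.Decidable using (does)
open import Data.Bool.Properties using (T?)

sortℕ : List ℕ → List ℕ
sortℕ = ISort.sort ≤-decTotalOrder

tuples : ℕ → ℕ → List (List ℕ)
tuples zero    n = [] ∷ []
tuples (suc k) n = concatMap (λ v → map (v ∷_) (tuples k n)) (map suc (upTo n))

indexBounded : ℕ → List ℕ → Bool
indexBounded i []       = true
indexBounded i (x ∷ xs) = (x ≤ᵇ i) ∧ indexBounded (suc i) xs

allPositive : List ℕ → Bool
allPositive []       = true
allPositive (x ∷ xs) = (1 ≤ᵇ x) ∧ allPositive xs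

isParking : List ℕ → Bool
isParking xs = allPositive xs ∧ indexBounded 1 (sortℕ xs)

removeOne1 : List ℕ → List (List ℕ)
removeOne1 []       = []
removeOne1 (x ∷ xs) =
  (if x ≡ᵇ 1 then xs ∷ [] else []) ++ᴸ map (x ∷_) (removeOne1 xs)
  where
  _++ᴸ_ : List (List ℕ) → List (List ℕ) → List (List ℕ)
  [] ++ᴸ ys       = ys
  (a ∷ as) ++ᴸ ys = a ∷ (as ++ᴸ ys)

allB : {A : Set} → (A → Bool) → List A → Bool
allB p []       = true
allB p (x ∷ xs) = p x ∧ allB p xs

isPrimeParking : List ℕ → Bool
isPrimeParking xs = isParking xs ∧ allB isParking (removeOne1 xs)

-- PPF_n, as a list without repetitions.  Every parking function of
-- length n has entries in {1,…,n}, so enumerating these tuples is complete.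
PPF : ℕ → List (List ℕ)
PPF n = filter (λ xs → T? (isPrimeParking xs)) (tuples n n)

-- a ≡ b (mod d), with modulus 0 meaning equality
congMod : ℕ → ℕ → ℕ → Bool
congMod zero    a b = a ≡ᵇ b
congMod (suc k) a b = (a % suc k) ≡ᵇ (b % suc k)

-- x_{i+1} - x_i ≡ ℓ (mod d)  ⟺  x_{i+1} ≡ x_i + ℓ (mod d)
forwardDiffCount : ℕ → ℕ → List ℕ → ℕ
forwardDiffCount d ℓ []           = 0
forwardDiffCount d ℓ (x ∷ [])     = 0
forwardDiffCount d ℓ (x ∷ y ∷ xs) =
  (if congMod d y (x + ℓ) then 1 else 0) + forwardDiffCount d ℓ (y ∷ xs)

Δf : ℕ → ℕ → List ℕ → ℕ
Δf n ℓ π = forwardDiffCount (n ∸ 1) ℓ π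

module _ {c r} (R : CommutativeSemiring c r) where
  open CommutativeSemiring R using (Carrier; 0#; 1#) renaming (_+_ to _+R_; _*_ to _*R_)
  sumR : List Carrier → Carrier
  sumR = foldr _+R_ 0#

  powR : Carrier → ℕ → Carrier
  powR x zero    = 1#
  powR x (suc k) = x *R powR x k

  natR : ℕ → Carrier
  natR zero    = 0#
  natR (suc k) = 1# +R natR k

-- Put N = n − 1. The weight q^Δℓ t^Δm of a sequence depends only on its consecutive differences
-- mod N, so it is invariant under rotating every entry v ↦ v + 1 (mod N) within [1, N]. Prime
-- parking functions of length n take their values in [1, N], and among the N rotations of any
-- x ∈ [1, N]^n exactly one is prime: if D is the quasi-periodic extension of j ↦ #{i : x_i ≤ j},
-- the s-th rotation is prime iff D grows by more than j on every window of length j ≤ N starting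
-- at N − s, and the last minimiser of D k − k is the unique such starting point. Hence the sum over
-- PPF_n is the sum of the weights of all x ∈ [1, N]^n with x₁ = 1. That sum factorises over
-- consecutive pairs: given x_i, one value of x_{i+1} contributes q, one contributes t and the other
-- N − 2 contribute 1, so it equals (q + t + N − 2)^N.

{-# OPTIONS --safe #-}
module Submission where

open import Defs
open import Algebra.Bundles using (CommutativeSemiring)
open import Data.Empty using (⊥-elim)
open import Data.List using (List; length; map)
open import Data.List.Relation.Unary.All using (All)
open import Data.Nat using (ℕ; zero; suc; _≤_; _<_; _∸_; z≤n; s≤s)
open import Data.Product using (_×_)
open import Relation.Binary.PropositionalEquality using (_≡_; _≢_; refl)

-- Arithmetic on ℕ is opened only inside the modules below: at top level its _+_ and _*_ would
-- clash with those of the semiring that the statement of proposition6p4 opens.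

InRange : ℕ → ℕ → Set
InRange M v = 1 ≤ v × v ≤ M

module Counting where

  open import Data.Bool using (Bool; T)
  open import Data.Bool.Properties using (T-∧)
  open import Data.List using (List; []; _∷_; length; map; filter)
  open import Data.List.Membership.Propositional using (_∈_)
  open import Data.List.Membership.Propositional.Properties using (∈-map⁺; ∈-map⁻)
  open import Data.List.Properties using (length-filter; filter-complete; filter-accept; filter-reject; filter-none; filter-all)
  open import Data.List.Relation.Binary.Permutation.Propositional using (_↭_; prep; swap; ↭-refl; ↭-trans)
  open import Data.List.Relation.Binary.Permutation.Propositional.Properties using (↭-length; filter-↭; All-resp-↭)
  open import Data.List.Relation.Unary.All as All using (All; []; _∷_)
  open import Data.List.Relation.Unary.All.Properties using (all-filter)
  open import Data.List.Relation.Unary.Any using (here; there)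
  open import Data.List.Relation.Unary.Linked using (Linked; []; [-]; _∷_)
  open import Data.List.Relation.Unary.Linked.Properties using (Linked⇒All)
  open import Data.Nat
  open import Data.Nat.Properties
  open import Data.Product using (_×_; _,_; proj₁; proj₂; ∃-syntax)
  open import Data.Sum using (_⊎_; inj₁; inj₂)
  import Data.List.Sort.InsertionSort.Properties as InsertionSort
  open import Function using (_∘_; Equivalence)
  open import Relation.Binary.PropositionalEquality
  open import Relation.Nullary using (yes; no; contradiction)

  open Equivalence using (to; from)

  count≤ : ℕ → List ℕ → ℕ
  count≤ j xs = length (filter (_≤? j) xs)

  count≤-accept : ∀ {j x} xs → x ≤ j → count≤ j (x ∷ xs) ≡ suc (count≤ j xs)
  count≤-accept xs x≤j = cong length (filter-accept (_≤? _) x≤j)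

  count≤-reject : ∀ {j x} xs → j < x → count≤ j (x ∷ xs) ≡ count≤ j xs
  count≤-reject xs j<x = cong length (filter-reject (_≤? _) (<⇒≱ j<x))

  count≤-↭ : ∀ j {xs ys} → xs ↭ ys → count≤ j xs ≡ count≤ j ys
  count≤-↭ j xs↭ys = ↭-length (filter-↭ (_≤? j) xs↭ys)

  count≤-∷ : ∀ j x xs → count≤ j xs ≤ count≤ j (x ∷ xs)
  count≤-∷ j x xs with x ≤? j
  ... | yes x≤j rewrite count≤-accept xs x≤j = n≤1+n _
  ... | no x≰j rewrite count≤-reject xs (≰⇒> x≰j) = ≤-refl

  count≤-all : ∀ {j xs} → All (_≤ j) xs → count≤ j xs ≡ length xs
  count≤-all xs≤j = cong length (filter-all (_≤? _) xs≤j)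

  count≤-none : ∀ {j xs} → All (j <_) xs → count≤ j xs ≡ 0
  count≤-none j<xs = cong length (filter-none (_≤? _) (All.map <⇒≱ j<xs))

  count≤-length⇒All : ∀ {j} xs → length xs ≤ count≤ j xs → All (_≤ j) xs
  count≤-length⇒All {j} xs len≤count = subst (All (_≤ j))
    (filter-complete (_≤? j) (≤-antisym (length-filter (_≤? j) xs) len≤count)) (all-filter (_≤? j) xs)

  count≤-mono : ∀ {j k} → j ≤ k → ∀ xs → count≤ j xs ≤ count≤ k xs
  count≤-mono j≤k [] = z≤n
  count≤-mono {j} {k} j≤k (x ∷ xs) with x ≤? j
  ... | yes x≤j rewrite count≤-accept xs x≤j | count≤-accept xs (≤-trans x≤j j≤k) =
    s≤s (count≤-mono j≤k xs)
  ... | no x≰j rewrite count≤-reject xs (≰⇒> x≰j) = ≤-trans (count≤-mono j≤k xs) (count≤-∷ k x xs)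

  allPositive⁺ : ∀ {xs} → All (1 ≤_) xs → T (allPositive xs)
  allPositive⁺ []         = _
  allPositive⁺ (1≤x ∷ ps) = from T-∧ (≤⇒≤ᵇ 1≤x , allPositive⁺ ps)

  allPositive⁻ : ∀ xs → T (allPositive xs) → All (1 ≤_) xs
  allPositive⁻ []       _ = []
  allPositive⁻ (x ∷ xs) h = ≤ᵇ⇒≤ 1 x (proj₁ (to T-∧ h)) ∷ allPositive⁻ xs (proj₂ (to T-∧ h))

  allB⁺ : ∀ {A : Set} (p : A → Bool) {xs} → All (T ∘ p) xs → T (allB p xs)
  allB⁺ p []         = _
  allB⁺ p (px ∷ pxs) = from T-∧ (px , allB⁺ p pxs)

  allB⁻ : ∀ {A : Set} (p : A → Bool) xs → T (allB p xs) → All (T ∘ p) xs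
  allB⁻ p []       _ = []
  allB⁻ p (x ∷ xs) h = proj₁ (to T-∧ h) ∷ allB⁻ p xs (proj₂ (to T-∧ h))

  indexBounded⇒counts : ∀ i l → T (indexBounded i l) → ∀ k → k < length l → suc k ≤ count≤ (i + k) l
  indexBounded⇒counts i (x ∷ xs) h zero _
    rewrite +-identityʳ i | count≤-accept xs (≤ᵇ⇒≤ x i (proj₁ (to T-∧ h))) = s≤s z≤n
  indexBounded⇒counts i (x ∷ xs) h (suc k) (s≤s k<len)
    rewrite +-suc i k | count≤-accept xs (m≤n⇒m≤1+n (≤-trans (≤ᵇ⇒≤ x i (proj₁ (to T-∧ h))) (m≤m+n i k))) =
    s≤s (indexBounded⇒counts (suc i) xs (proj₂ (to T-∧ h)) k k<len)

  count≤-sorted-below : ∀ {j x xs} → Linked _≤_ (x ∷ xs) → j < x → count≤ j (x ∷ xs) ≡ 0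
  count≤-sorted-below sorted j<x = count≤-none (Linked⇒All ≤-trans j<x sorted)

  indexBounded⇐counts : ∀ i l → Linked _≤_ l → (∀ k → k < length l → suc k ≤ count≤ (i + k) l) →
    T (indexBounded i l)
  indexBounded⇐counts i []       _      _      = _
  indexBounded⇐counts i (x ∷ xs) sorted counts with x ≤? i
  ... | no x≰i = contradiction (counts 0 z<s) λ 1≤c →
    1+n≰n (subst (1 ≤_) (trans (cong (λ j → count≤ j (x ∷ xs)) (+-identityʳ i))
                               (count≤-sorted-below sorted (≰⇒> x≰i))) 1≤c)
  ... | yes x≤i = from T-∧ (≤⇒≤ᵇ x≤i , indexBounded⇐counts (suc i) xs (Linked-tail sorted) λ k k<len →
    subst (λ j → suc k ≤ count≤ j xs) (+-suc i k)
      (≤-pred (subst (suc (suc k) ≤_) (count≤-accept xs (≤-trans x≤i (m≤m+n i (suc k)))) (counts (suc k) (s≤s k<len)))))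
    where
    Linked-tail : ∀ {y ys} → Linked _≤_ (y ∷ ys) → Linked _≤_ ys
    Linked-tail [-]       = []
    Linked-tail (_ ∷ lys) = lys

  ParkingCounts : List ℕ → Set
  ParkingCounts xs = ∀ k → k < length xs → suc k ≤ count≤ (suc k) xs

  open InsertionSort ≤-decTotalOrder using (sort-↭; sort-↗)

  isParking⇒counts : ∀ xs → T (isParking xs) → ParkingCounts xs
  isParking⇒counts xs parking k k<len =
    subst (suc k ≤_) (count≤-↭ (suc k) (sort-↭ xs))
      (indexBounded⇒counts 1 (sortℕ xs) (proj₂ (to T-∧ parking)) k (subst (k <_) (sym (↭-length (sort-↭ xs))) k<len))

  counts⇒isParking : ∀ xs → All (1 ≤_) xs → ParkingCounts xs → T (isParking xs)
  counts⇒isParking xs pos counts =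
    from T-∧ (allPositive⁺ pos , indexBounded⇐counts 1 (sortℕ xs) (sort-↗ xs) λ k k<len →
    subst (suc k ≤_) (sym (count≤-↭ (suc k) (sort-↭ xs))) (counts k (subst (k <_) (↭-length (sort-↭ xs)) k<len)))

  removeOne1-∷⁻ : ∀ x xs {ys} → ys ∈ removeOne1 (x ∷ xs) →
    (x ≡ 1 × ys ≡ xs) ⊎ ∃[ ys′ ] ys′ ∈ removeOne1 xs × ys ≡ x ∷ ys′
  removeOne1-∷⁻ (suc zero)    xs (here ys≡xs) = inj₁ (refl , ys≡xs)
  removeOne1-∷⁻ (suc zero)    xs (there ys∈)  = inj₂ (∈-map⁻ (1 ∷_) ys∈)
  removeOne1-∷⁻ zero          xs ys∈          = inj₂ (∈-map⁻ (0 ∷_) ys∈)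
  removeOne1-∷⁻ (suc (suc k)) xs ys∈          = inj₂ (∈-map⁻ (suc (suc k) ∷_) ys∈)

  removeOne1-↭ : ∀ xs {ys} → ys ∈ removeOne1 xs → xs ↭ 1 ∷ ys
  removeOne1-↭ (x ∷ xs) ys∈ with removeOne1-∷⁻ x xs ys∈
  ... | inj₁ (refl , refl)          = ↭-refl
  ... | inj₂ (ys′ , ys′∈ , refl)    = ↭-trans (prep x (removeOne1-↭ xs ys′∈)) (swap x 1 ↭-refl)

  removeOne1-nonempty : ∀ xs → All (1 ≤_) xs → 1 ≤ count≤ 1 xs → ∃[ ys ] ys ∈ removeOne1 xs
  removeOne1-nonempty (zero ∷ xs)        (() ∷ _)  _
  removeOne1-nonempty (suc zero ∷ xs)    _         _   = xs , here refl
  removeOne1-nonempty (suc (suc k) ∷ xs) (_ ∷ pos) 1≤c with removeOne1-nonempty xs pos 1≤c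
  ... | ys , ys∈ = suc (suc k) ∷ ys , ∈-map⁺ (suc (suc k) ∷_) ys∈

  PrimeCounts : ℕ → List ℕ → Set
  PrimeCounts N xs = ∀ j → 1 ≤ j → j ≤ N → suc j ≤ count≤ j xs

  isPrimeParking⇒counts : ∀ N xs → length xs ≡ suc N → T (isPrimeParking xs) → PrimeCounts N xs
  isPrimeParking⇒counts N xs len prime (suc k) _ k<N =
    subst (suc (suc k) ≤_) (sym (count≤-↭ (suc k) xs↭)) (s≤s (isParking⇒counts ys ys-parking k k<len))
    where
    parking = proj₁ (to T-∧ prime)
    removal = removeOne1-nonempty xs (allPositive⁻ xs (proj₁ (to T-∧ parking)))
                (isParking⇒counts xs parking 0 (subst (0 <_) (sym len) z<s))
    ys = proj₁ removal
    xs↭ = removeOne1-↭ xs (proj₂ removal)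
    ys-parking = All.lookup (allB⁻ isParking _ (proj₂ (to T-∧ prime))) (proj₂ removal)
    k<len : k < length ys
    k<len = subst (k <_) (sym (suc-injective (trans (sym (↭-length xs↭)) len))) k<N

  isPrimeParking⇒All≤ : ∀ N xs → 1 ≤ N → length xs ≡ suc N → T (isPrimeParking xs) → All (_≤ N) xs
  isPrimeParking⇒All≤ N xs 1≤N len prime =
    count≤-length⇒All xs (subst (_≤ count≤ N xs) (sym len) (isPrimeParking⇒counts N xs len prime N 1≤N ≤-refl))

  counts⇒isPrimeParking : ∀ N xs → 1 ≤ N → length xs ≡ suc N → All (1 ≤_) xs → PrimeCounts N xs →
    T (isPrimeParking xs)
  counts⇒isPrimeParking N xs 1≤N len pos counts =
    from T-∧ (counts⇒isParking xs pos parkingCounts , allB⁺ isParking (All.tabulate removalParking))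
    where
    parkingCounts : ParkingCounts xs
    parkingCounts k k<len with m≤n⇒m<n∨m≡n (≤-pred (subst (k <_) len k<len))
    ... | inj₁ k<N  = <⇒≤ (counts (suc k) z<s k<N)
    ... | inj₂ refl = ≤-trans (counts k 1≤N ≤-refl) (count≤-mono (n≤1+n k) xs)
    removalParking : ∀ {ys} → ys ∈ removeOne1 xs → T (isParking ys)
    removalParking {ys} ys∈ = counts⇒isParking ys (All.tail (All-resp-↭ xs↭ pos)) λ k k<len →
      ≤-pred (subst (suc (suc k) ≤_) (count≤-↭ (suc k) xs↭)
        (counts (suc k) z<s (subst (k <_) (suc-injective (trans (sym (↭-length xs↭)) len)) k<len)))
      where xs↭ = removeOne1-↭ xs ys∈


module CycleLemma (N : ℕ) (D : ℕ → ℕ) where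

  open import Data.Empty using (⊥; ⊥-elim)
  open import Data.Nat
  open import Data.Nat.Properties
  open import Data.Nat.Solver using (module +-*-Solver)
  open import Data.Product using (_×_; _,_; ∃-syntax)
  open import Data.Sum using (inj₁; inj₂)
  open import Function using (case_of_)
  open import Relation.Binary.Definitions using (tri<; tri≈; tri>)
  open import Relation.Binary.PropositionalEquality
  open import Relation.Nullary using (yes; no; contradiction)
  open +-*-Solver

  Good : ℕ → Set
  Good p = ∀ j → 1 ≤ j → j ≤ N → D p + suc j ≤ D (p + j)

  -- k ≼ k′ and k ≺ k′ compare D k − k with D k′ − k′ without subtracting.
  infix 4 _≼_ _≺_
  _≼_ _≺_ : ℕ → ℕ → Set
  k ≼ k′ = D k + k′ ≤ D k′ + k
  k ≺ k′ = D k + k′ < D k′ + k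

  ≼-trans : ∀ {a b c} → a ≼ b → b ≼ c → a ≼ c
  ≼-trans {a} {b} {c} a≼b b≼c = +-cancelʳ-≤ (D b + b) (D a + c) (D c + a) (begin
    D a + c + (D b + b)  ≡⟨ solve 4 (λ x y u v → x :+ v :+ (y :+ u) := x :+ u :+ (y :+ v)) refl (D a) (D b) b c ⟩
    D a + b + (D b + c)  ≤⟨ +-mono-≤ a≼b b≼c ⟩
    D b + a + (D c + b)  ≡⟨ solve 4 (λ x y u v → x :+ u :+ (y :+ v) := y :+ u :+ (x :+ v)) refl (D b) (D c) a b ⟩
    D c + a + (D b + b)  ∎)
    where open ≤-Reasoning

  record LastMinimiser (M p : ℕ) : Set where
    field
      1≤p     : 1 ≤ p
      p≤M     : p ≤ M
      minimal : ∀ k → 1 ≤ k → k ≤ M → p ≼ k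
      last    : ∀ k → p < k → k ≤ M → p ≺ k

  lastMinimiser : ∀ M → 1 ≤ M → ∃[ p ] LastMinimiser M p
  lastMinimiser (suc zero) _ = 1 , record
    { 1≤p     = ≤-refl
    ; p≤M     = ≤-refl
    ; minimal = λ k 1≤k k≤1 → subst (1 ≼_) (≤-antisym 1≤k k≤1) ≤-refl
    ; last    = λ k 1<k k≤1 → contradiction k≤1 (<⇒≱ 1<k)
    }
  lastMinimiser (suc (suc M)) _ with lastMinimiser (suc M) (s≤s z≤n)
  ... | p , lm with D (suc (suc M)) + p ≤? D p + suc (suc M)
  ...   | yes K≼p = suc (suc M) , record
    { 1≤p     = s≤s z≤n
    ; p≤M     = ≤-refl
    ; minimal = λ k 1≤k k≤K → case m≤n⇒m<n∨m≡n k≤K of λ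
        { (inj₁ (s≤s k≤M)) → ≼-trans K≼p (minimal k 1≤k k≤M)
        ; (inj₂ refl)      → ≤-refl }
    ; last    = λ k K<k k≤K → contradiction k≤K (<⇒≱ K<k)
    }
    where open LastMinimiser lm
  ...   | no K⋠p = p , record
    { 1≤p     = 1≤p
    ; p≤M     = m≤n⇒m≤1+n p≤M
    ; minimal = λ k 1≤k k≤K → case m≤n⇒m<n∨m≡n k≤K of λ
        { (inj₁ (s≤s k≤M)) → minimal k 1≤k k≤M
        ; (inj₂ refl)      → <⇒≤ (≰⇒> K⋠p) }
    ; last    = λ k p<k k≤K → case m≤n⇒m<n∨m≡n k≤K of λ
        { (inj₁ (s≤s k≤M)) → last k p<k k≤M
        ; (inj₂ refl)      → ≰⇒> K⋠p }
    }
    where open LastMinimiser lm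

  ≺⇒gap : ∀ {p j} → p ≺ p + j → D p + suc j ≤ D (p + j)
  ≺⇒gap {p} {j} p≺p+j = +-cancelʳ-≤ p (D p + suc j) (D (p + j)) (begin
    D p + suc j + p      ≡⟨ solve 3 (λ x p j → x :+ (con 1 :+ j) :+ p := con 1 :+ (x :+ (p :+ j))) refl (D p) p j ⟩
    suc (D p + (p + j))  ≤⟨ p≺p+j ⟩
    D (p + j) + p        ∎)
    where open ≤-Reasoning


  module QuasiPeriodic (D-shift : ∀ k → k ≤ N → D (k + N) ≡ D k + suc N) where

    ≼⇒wrapped-gap : ∀ {p j k} → k + N ≡ p + j → k ≤ N → p ≼ k → D p + suc j ≤ D (p + j)
    ≼⇒wrapped-gap {p} {j} {k} k+N≡p+j k≤N p≼k = +-cancelʳ-≤ p (D p + suc j) (D (p + j)) (begin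
      D p + suc j + p      ≡⟨ solve 3 (λ x p j → x :+ (con 1 :+ j) :+ p := con 1 :+ (x :+ (p :+ j))) refl (D p) p j ⟩
      suc (D p + (p + j))  ≡⟨ cong (λ i → suc (D p + i)) (sym k+N≡p+j) ⟩
      suc (D p + (k + N))  ≡⟨ solve 3 (λ x k n → con 1 :+ (x :+ (k :+ n)) := x :+ k :+ (con 1 :+ n)) refl (D p) k N ⟩
      D p + k + suc N      ≤⟨ +-monoˡ-≤ (suc N) p≼k ⟩
      D k + p + suc N      ≡⟨ solve 3 (λ y p n → y :+ p :+ (con 1 :+ n) := y :+ (con 1 :+ n) :+ p) refl (D k) p N ⟩
      D k + suc N + p      ≡⟨ cong (_+ p) (sym (D-shift k k≤N)) ⟩
      D (k + N) + p        ≡⟨ cong (λ i → D i + p) k+N≡p+j ⟩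
      D (p + j) + p        ∎)
      where open ≤-Reasoning

    lastMinimiser⇒Good : ∀ {p} → LastMinimiser N p → Good p
    lastMinimiser⇒Good {p} lm j 1≤j j≤N with p + j ≤? N
    ... | yes p+j≤N = ≺⇒gap (last (p + j) (m<m+n p 1≤j) p+j≤N)
      where open LastMinimiser lm
    ... | no p+j≰N = ≼⇒wrapped-gap (m∸n+n≡m N≤p+j) k≤N (minimal k (m<n⇒0<n∸m (≰⇒> p+j≰N)) k≤N)
      where
      open LastMinimiser lm
      k = p + j ∸ N
      N≤p+j = <⇒≤ (≰⇒> p+j≰N)
      k≤N : k ≤ N
      k≤N = m≤n+o⇒m∸n≤o (p + j) N (+-mono-≤ p≤M j≤N)

    Good-exists : 1 ≤ N → ∃[ p ] 1 ≤ p × p ≤ N × Good p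
    Good-exists 1≤N with lastMinimiser N 1≤N
    ... | p , lm = p , 1≤p , p≤M , lastMinimiser⇒Good lm
      where open LastMinimiser lm

    -- Two good indices p < p′ would force D to grow by more than N + 1 over one period.
    Good-<-absurd : ∀ {p p′} → 1 ≤ p → p < p′ → p′ ≤ N → Good p → Good p′ → ⊥
    Good-<-absurd {p} {p′} 1≤p p<p′ p′≤N good good′ = 1+n≰n (begin
      suc (D p + suc N)         ≡⟨ cong (λ i → suc (D p + suc i)) (sym j+j′≡N) ⟩
      suc (D p + suc (j + j′))  ≡⟨ solve 3 (λ x j j′ → con 1 :+ (x :+ (con 1 :+ (j :+ j′)))
                                                      := x :+ (con 1 :+ j) :+ (con 1 :+ j′)) refl (D p) j j′ ⟩
      D p + suc j + suc j′      ≤⟨ +-monoˡ-≤ (suc j′) (subst (λ i → D p + suc j ≤ D i) p+j≡p′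
                                                                (good j 1≤j j≤N)) ⟩
      D p′ + suc j′             ≤⟨ subst (λ i → D p′ + suc j′ ≤ D i) p′+j′≡p+N (good′ j′ 1≤j′ j′≤N) ⟩
      D (p + N)                 ≡⟨ D-shift p (≤-trans (<⇒≤ p<p′) p′≤N) ⟩
      D p + suc N               ∎)
      where
      open ≤-Reasoning
      j = p′ ∸ p
      j′ = p + N ∸ p′
      p+j≡p′ : p + j ≡ p′
      p+j≡p′ = m+[n∸m]≡n (<⇒≤ p<p′)
      p′+j′≡p+N : p′ + j′ ≡ p + N
      p′+j′≡p+N = m+[n∸m]≡n (≤-trans p′≤N (m≤n+m N p))
      j+j′≡N : j + j′ ≡ N
      j+j′≡N = +-cancelˡ-≡ p (j + j′) N (begin-equality
        p + (j + j′)  ≡⟨ sym (+-assoc p j j′) ⟩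
        p + j + j′    ≡⟨ cong (_+ j′) p+j≡p′ ⟩
        p′ + j′       ≡⟨ p′+j′≡p+N ⟩
        p + N         ∎)
      1≤j : 1 ≤ j
      1≤j = m<n⇒0<n∸m p<p′
      j≤N : j ≤ N
      j≤N = ≤-trans (m∸n≤m p′ p) p′≤N
      1≤j′ : 1 ≤ j′
      1≤j′ = m<n⇒0<n∸m (≤-trans (s≤s p′≤N) (+-monoˡ-≤ N 1≤p))
      j′≤N : j′ ≤ N
      j′≤N = m≤n+o⇒m∸n≤o (p + N) p′ (+-monoˡ-≤ N (<⇒≤ p<p′))

    Good-unique : ∀ {p p′} → 1 ≤ p → p ≤ N → 1 ≤ p′ → p′ ≤ N → Good p → Good p′ → p ≡ p′
    Good-unique {p} {p′} 1≤p p≤N 1≤p′ p′≤N good good′ with <-cmp p p′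
    ... | tri< p<p′ _ _ = ⊥-elim (Good-<-absurd 1≤p p<p′ p′≤N good good′)
    ... | tri≈ _ p≡p′ _ = p≡p′
    ... | tri> _ _ p′<p = ⊥-elim (Good-<-absurd 1≤p′ p′<p p≤N good′ good)


module Rotation (N-1 : ℕ) where

  open import Data.Bool using (true; if_then_else_)
  open import Data.Bool.Properties using (T-≡; ⇔→≡)
  open import Data.List using (List; []; _∷_; length; map)
  open import Data.List.Properties using (length-map)
  open import Data.List.Relation.Unary.All as All using (All; []; _∷_)
  open import Data.List.Relation.Unary.All.Properties using (map⁺)
  open import Data.Nat
  open import Data.Nat.DivMod using (m<n⇒m%n≡m; n%n≡0; m%n%n≡m%n; m%n<n; %-distribˡ-+; %-remove-+ˡ)
  open import Data.Nat.Divisibility using (∣-refl)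
  open import Data.Nat.Properties
  open import Data.Product using (_,_)
  open import Data.Sum using (inj₁; inj₂)
  open import Function using (Equivalence; mk⇔)
  open import Relation.Nullary using (yes; no)
  open import Relation.Binary.PropositionalEquality

  open Counting using (count≤; count≤-accept; count≤-reject)
  open Equivalence using (to; from)

  ≡ᵇ-cong : ∀ {a b c d} → (a ≡ b → c ≡ d) → (c ≡ d → a ≡ b) → (a ≡ᵇ b) ≡ (c ≡ᵇ d)
  ≡ᵇ-cong {a} {b} {c} {d} ⇒ ⇐ = ⇔→≡ {z = true} (mk⇔
    (λ e → to T-≡ (≡⇒≡ᵇ c d (⇒ (≡ᵇ⇒≡ a b (from T-≡ e)))))
    (λ e → to T-≡ (≡⇒≡ᵇ a b (⇐ (≡ᵇ⇒≡ c d (from T-≡ e))))))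

  N : ℕ
  N = suc N-1

  %-cong-+ : ∀ {a b c d} → a % N ≡ b % N → c % N ≡ d % N → (a + c) % N ≡ (b + d) % N
  %-cong-+ {a} {b} {c} {d} a≡b c≡d = begin
    (a + c) % N              ≡⟨ %-distribˡ-+ a c N ⟩
    (a % N + c % N) % N      ≡⟨ cong₂ (λ x y → (x + y) % N) a≡b c≡d ⟩
    (b % N + d % N) % N      ≡⟨ %-distribˡ-+ b d N ⟨
    (b + d) % N              ∎
    where open ≡-Reasoning

  suc-%-injective : ∀ {a b} → suc a % N ≡ suc b % N → a % N ≡ b % N
  suc-%-injective {a} {b} e = trans (back a) (trans (%-cong-+ {N-1} {N-1} refl e) (sym (back b)))
    where
    back : ∀ x → x % N ≡ (N-1 + suc x) % N
    back x = trans (sym (%-remove-+ˡ x (∣-refl {N}))) (cong (_% N) (sym (+-suc N-1 x)))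

  congMod-suc : ∀ a b → congMod N (suc a) (suc b) ≡ congMod N a b
  congMod-suc a b = ≡ᵇ-cong suc-%-injective (%-cong-+ {1} {1} refl)

  congMod-< : ∀ {a b} → a < N → b < N → congMod N a b ≡ (a ≡ᵇ b)
  congMod-< a<N b<N = cong₂ _≡ᵇ_ (m<n⇒m%n≡m a<N) (m<n⇒m%n≡m b<N)

  rot : ℕ → ℕ
  rot v = suc (v % N)

  rot-< : ∀ {v} → v < N → rot v ≡ suc v
  rot-< v<N = cong suc (m<n⇒m%n≡m v<N)

  rot-N : rot N ≡ 1
  rot-N = cong suc (n%n≡0 N)

  rot-InRange : ∀ v → InRange N (rot v)
  rot-InRange v = s≤s z≤n , m%n<n v N

  rot-% : ∀ v → rot v % N ≡ suc v % N
  rot-% v = %-cong-+ {1} {1} refl (m%n%n≡m%n v N)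

  congMod-rot : ∀ x y ℓ → congMod N (rot y) (rot x + ℓ) ≡ congMod N y (x + ℓ)
  congMod-rot x y ℓ =
    trans (cong₂ _≡ᵇ_ (rot-% y) (%-cong-+ {rot x} {suc x} {ℓ} {ℓ} (rot-% x) refl)) (congMod-suc y (x + ℓ))

  rotate : ℕ → List ℕ → List ℕ
  rotate zero    xs = xs
  rotate (suc c) xs = map rot (rotate c xs)

  forwardDiffCount-map-rot : ∀ ℓ xs → forwardDiffCount N ℓ (map rot xs) ≡ forwardDiffCount N ℓ xs
  forwardDiffCount-map-rot ℓ []           = refl
  forwardDiffCount-map-rot ℓ (x ∷ [])     = refl
  forwardDiffCount-map-rot ℓ (x ∷ y ∷ xs) =
    cong₂ (λ b n → (if b then 1 else 0) + n) (congMod-rot x y ℓ) (forwardDiffCount-map-rot ℓ (y ∷ xs))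

  forwardDiffCount-rotate : ∀ ℓ c xs → forwardDiffCount N ℓ (rotate c xs) ≡ forwardDiffCount N ℓ xs
  forwardDiffCount-rotate ℓ zero    xs = refl
  forwardDiffCount-rotate ℓ (suc c) xs = trans (forwardDiffCount-map-rot ℓ (rotate c xs)) (forwardDiffCount-rotate ℓ c xs)

  rotate-∷ : ∀ {c} → c < N → ∀ xs → rotate c (1 ∷ xs) ≡ suc c ∷ rotate c xs
  rotate-∷ {zero}  _   xs = refl
  rotate-∷ {suc c} c<N xs =
    trans (cong (map rot) (rotate-∷ (<⇒≤ c<N) xs)) (cong (_∷ rotate (suc c) xs) (rot-< c<N))

  rotate-InRange : ∀ {xs} → All (InRange N) xs → ∀ c → All (InRange N) (rotate c xs)
  rotate-InRange range zero    = range
  rotate-InRange range (suc c) = map⁺ (All.universal rot-InRange _)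

  length-rotate : ∀ c xs → length (rotate c xs) ≡ length xs
  length-rotate zero    xs = refl
  length-rotate (suc c) xs = trans (length-map rot (rotate c xs)) (length-rotate c xs)

  -- rot sends N to 1 and v < N to v + 1, so #{v : rot v ≤ j + 1} = #{v : v ≤ j} + #{v : v = N}.
  count≤-map-rot : ∀ {j} → j < N → ∀ xs → All (InRange N) xs →
    count≤ (suc j) (map rot xs) + count≤ N-1 xs ≡ count≤ j xs + count≤ N xs
  count≤-map-rot j<N [] [] = refl
  count≤-map-rot {j} j<N (v ∷ xs) ((_ , v≤N) ∷ range) with m≤n⇒m<n∨m≡n v≤N
  ... | inj₂ refl
    rewrite count≤-accept {suc j} (map rot xs) (subst (_≤ suc j) (sym rot-N) (s≤s z≤n))
          | count≤-reject {N-1} xs ≤-refl | count≤-reject {j} xs j<N | count≤-accept {N} xs ≤-refl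
    = trans (cong suc (count≤-map-rot j<N xs range)) (sym (+-suc _ _))
  ... | inj₁ v<N with v ≤? j
  ...   | yes v≤j
    rewrite count≤-accept {suc j} (map rot xs) (subst (_≤ suc j) (sym (rot-< v<N)) (s≤s v≤j))
          | count≤-accept {N-1} xs (≤-pred v<N)
          | count≤-accept {j} xs v≤j | count≤-accept {N} xs v≤N
    = cong suc (trans (+-suc _ _) (trans (cong suc (count≤-map-rot j<N xs range)) (sym (+-suc _ _))))
  ...   | no v≰j
    rewrite count≤-reject {suc j} (map rot xs) (subst (suc j <_) (sym (rot-< v<N)) (s≤s (≰⇒> v≰j)))
          | count≤-accept {N-1} xs (≤-pred v<N)
          | count≤-reject {j} xs (≰⇒> v≰j) | count≤-accept {N} xs v≤N
    = trans (+-suc _ _) (trans (cong suc (count≤-map-rot j<N xs range)) (sym (+-suc _ _)))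


module Orbit (N-1 : ℕ) (z : List ℕ) (z-range : All (InRange (suc N-1)) z) (z-length : length z ≡ suc (suc N-1))
  where

  open import Data.Bool using (T)
  open import Data.List using (length; map)
  open import Data.List.Relation.Unary.All as All using (All)
  open import Data.Nat
  open import Data.Nat.Properties
  open import Data.Nat.Solver using (module +-*-Solver)
  open import Data.Product using (_×_; _,_; proj₁; proj₂; ∃-syntax)
  open import Relation.Binary.PropositionalEquality
  open +-*-Solver
  open Counting
  open Rotation N-1

  count≤-z-full : ∀ {k} → N ≤ k → count≤ k z ≡ suc N
  count≤-z-full N≤k = trans (count≤-all (All.map (λ r → ≤-trans (proj₂ r) N≤k) z-range)) z-length

  -- Extends k ↦ count≤ k z from [0, N] to [0, 2N] so that it jumps by N + 1 per period.
  D : ℕ → ℕ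
  D k = count≤ k z + count≤ (k ∸ N) z

  D-low : ∀ {k} → k ≤ N → D k ≡ count≤ k z
  D-low {k} k≤N = begin
    count≤ k z + count≤ (k ∸ N) z  ≡⟨ cong (λ i → count≤ k z + count≤ i z) (m≤n⇒m∸n≡0 k≤N) ⟩
    count≤ k z + count≤ 0 z        ≡⟨ cong (count≤ k z +_) (count≤-none (All.map proj₁ z-range)) ⟩
    count≤ k z + 0                 ≡⟨ +-identityʳ _ ⟩
    count≤ k z                     ∎
    where open ≡-Reasoning

  D-shift : ∀ k → k ≤ N → D (k + N) ≡ D k + suc N
  D-shift k k≤N = begin
    count≤ (k + N) z + count≤ (k + N ∸ N) z  ≡⟨ cong₂ _+_ (count≤-z-full (m≤n+m N k))
                                                          (cong (λ i → count≤ i z) (m+n∸n≡m k N)) ⟩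
    suc N + count≤ k z                       ≡⟨ +-comm (suc N) _ ⟩
    count≤ k z + suc N                       ≡⟨ cong (_+ suc N) (D-low k≤N) ⟨
    D k + suc N                              ∎
    where open ≡-Reasoning

  open CycleLemma N D
  open QuasiPeriodic D-shift

  count≤-rotate : ∀ s {p} → s + p ≡ N → ∀ j → j ≤ N → count≤ j (rotate s z) + D p ≡ D (p + j)
  count≤-rotate zero refl j j≤N = begin
    count≤ j z + D N      ≡⟨ cong (count≤ j z +_) (trans (D-low ≤-refl) (count≤-z-full ≤-refl)) ⟩
    count≤ j z + suc N    ≡⟨ cong (_+ suc N) (D-low j≤N) ⟨
    D j + suc N           ≡⟨ D-shift j j≤N ⟨
    D (j + N)             ≡⟨ cong D (+-comm j N) ⟩
    D (N + j)             ∎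
    where open ≡-Reasoning
  count≤-rotate (suc s) {p} _ zero _ =
    cong₂ _+_ (count≤-none (All.map proj₁ (rotate-InRange z-range (suc s)))) (cong D (sym (+-identityʳ p)))
  count≤-rotate (suc s) {p} s+p≡N (suc j) (s≤s j≤N-1) = +-cancelʳ-≡ (suc N) _ _ (begin
    A + D p + suc N        ≡⟨ +-assoc A (D p) (suc N) ⟩
    A + (D p + suc N)      ≡⟨ cong (A +_) wrap ⟨
    A + (B + E)            ≡⟨ +-assoc A B E ⟨
    A + B + E              ≡⟨ cong (_+ E) (count≤-map-rot (s≤s j≤N-1) x x-range) ⟩
    C + count≤ N x + E     ≡⟨ cong (λ u → C + u + E) x-full ⟩
    C + suc N + E          ≡⟨ solve 3 (λ c n e → c :+ n :+ e := c :+ e :+ n) refl C (suc N) E ⟩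
    C + E + suc N          ≡⟨ cong (_+ suc N) (trans step (cong D (sym (+-suc p j)))) ⟩
    D (p + suc j) + suc N  ∎)
    where
    open ≡-Reasoning
    x = rotate s z
    x-range = rotate-InRange z-range s
    A = count≤ (suc j) (map rot x)
    B = count≤ N-1 x
    C = count≤ j x
    E = D (suc p)
    s+1+p≡N : s + suc p ≡ N
    s+1+p≡N = trans (+-suc s p) s+p≡N
    x-full : count≤ N x ≡ suc N
    x-full = trans (count≤-all (All.map proj₂ x-range)) (trans (length-rotate s z) z-length)
    step : C + E ≡ D (suc p + j)
    step = count≤-rotate s s+1+p≡N j (m≤n⇒m≤1+n j≤N-1)
    wrap : B + E ≡ D p + suc N
    wrap = begin
      B + E            ≡⟨ count≤-rotate s s+1+p≡N N-1 (n≤1+n N-1) ⟩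
      D (suc p + N-1)  ≡⟨ cong D (+-suc p N-1) ⟨
      D (p + N)        ≡⟨ D-shift p (subst (p ≤_) s+p≡N (m≤n+m p (suc s))) ⟩
      D p + suc N      ∎

  module _ {s} (s<N : s < N) where

    private
      p = N ∸ s
      s+p≡N : s + p ≡ N
      s+p≡N = m+[n∸m]≡n (<⇒≤ s<N)
      length≡ : length (rotate s z) ≡ suc N
      length≡ = trans (length-rotate s z) z-length
      counts≡ : ∀ j → j ≤ N → D p + count≤ j (rotate s z) ≡ D (p + j)
      counts≡ j j≤N = trans (+-comm (D p) _) (count≤-rotate s s+p≡N j j≤N)

    isPrimeParking⇒Good : T (isPrimeParking (rotate s z)) → Good (N ∸ s)
    isPrimeParking⇒Good prime j 1≤j j≤N =
      subst (D p + suc j ≤_) (counts≡ j j≤N)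
        (+-monoʳ-≤ (D p) (isPrimeParking⇒counts N (rotate s z) length≡ prime j 1≤j j≤N))

    Good⇒isPrimeParking : Good (N ∸ s) → T (isPrimeParking (rotate s z))
    Good⇒isPrimeParking good = counts⇒isPrimeParking N (rotate s z) (s≤s z≤n) length≡
      (All.map proj₁ (rotate-InRange z-range s))
      λ j 1≤j j≤N → +-cancelˡ-≤ (D p) _ _ (subst (D p + suc j ≤_) (sym (counts≡ j j≤N)) (good j 1≤j j≤N))

  primeRotation-exists : ∃[ c ] c < N × T (isPrimeParking (rotate c z))
  primeRotation-exists with Good-exists (s≤s z≤n)
  ... | p , 1≤p , p≤N , good = N ∸ p , c<N , Good⇒isPrimeParking c<N (subst Good (sym (m∸[m∸n]≡n p≤N)) good)
    where
    c<N : N ∸ p < N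
    c<N = ∸-monoʳ-< {N} {p} {0} 1≤p p≤N

  primeRotation-unique : ∀ {c c′} → c < N → c′ < N →
    T (isPrimeParking (rotate c z)) → T (isPrimeParking (rotate c′ z)) → c ≡ c′
  primeRotation-unique {c} {c′} c<N c′<N prime prime′ = begin
    c            ≡⟨ m∸[m∸n]≡n (<⇒≤ c<N) ⟨
    N ∸ (N ∸ c)  ≡⟨ cong (N ∸_) (Good-unique (m<n⇒0<n∸m c<N) (m∸n≤m N c) (m<n⇒0<n∸m c′<N) (m∸n≤m N c′)
                      (isPrimeParking⇒Good c<N prime) (isPrimeParking⇒Good c′<N prime′)) ⟩
    N ∸ (N ∸ c′) ≡⟨ m∸[m∸n]≡n (<⇒≤ c′<N) ⟩
    c′           ∎
    where open ≡-Reasoning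


module Sums {c r} (R : CommutativeSemiring c r) where

  open import Data.Bool using (Bool; true; false; T; if_then_else_)
  open import Data.Bool.Properties using (T?)
  open import Data.Fin using (Fin; zero; suc; toℕ; fromℕ; inject₁; punchIn; punchOut)
  open import Data.Fin.Properties using (toℕ<n; toℕ-fromℕ; toℕ-inject₁; punchIn-injective; punchInᵢ≢i; punchIn-punchOut)
  open import Data.List using (List; []; _∷_; _++_; length; map; filter; concatMap; applyUpTo; upTo)
  open import Data.List.Properties using (map-concatMap; map-upTo; map-∘)
  open import Data.List.Relation.Unary.All as All using (All; []; _∷_)
  open import Data.Nat
  open import Data.Nat.Properties
  open import Data.Product using (_,_)
  open import Function using (_∘_)
  open import Relation.Binary.PropositionalEquality
  open import Relation.Nullary using (¬_; contradiction)

  open CommutativeSemiring R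
    using (Carrier; _≈_; 0#; 1#; semiring; reflexive; +-cong; +-congˡ; *-congˡ; *-congʳ; zeroˡ)
    renaming (_+_ to _⊕_; _*_ to _⊗_; refl to ≈-refl; sym to ≈-sym; trans to ≈-trans; setoid to ≈-setoid;
              +-assoc to ⊕-assoc; +-comm to ⊕-comm; +-identityˡ to ⊕-identityˡ; +-identityʳ to ⊕-identityʳ;
              *-identityˡ to ⊗-identityˡ)
  open import Algebra.Properties.Semiring.Sum semiring
    using (sum; sum-syntax; sum-cong-≋; sum-remove; sum-init-last; sum-replicate-zero; ∑-comm; *-distribˡ-sum; *-distribʳ-sum)
  open import Relation.Binary.Reasoning.Setoid ≈-setoid

  indicator : Bool → Carrier
  indicator b = if b then 1# else 0#

  indicator-true : ∀ {b} → T b → indicator b ≡ 1#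
  indicator-true {true} _ = refl

  indicator-false : ∀ {b} → ¬ T b → indicator b ≡ 0#
  indicator-false {false} _   = refl
  indicator-false {true}  ¬tt = contradiction _ ¬tt

  sum-zero : ∀ {n} {f : Fin n → Carrier} → (∀ i → f i ≈ 0#) → sum f ≈ 0#
  sum-zero {n} f≈0 = ≈-trans (sum-cong-≋ f≈0) (sum-replicate-zero n)

  sum-one : ∀ {n} {f : Fin n → Carrier} → (∀ i → f i ≈ 1#) → sum f ≈ natR R n
  sum-one {zero}  f≈1 = ≈-refl
  sum-one {suc n} f≈1 = +-cong (f≈1 zero) (sum-one (f≈1 ∘ suc))

  sum-indicator-unique : ∀ {n} (b : Fin n → Bool) {i} → T (b i) → (∀ j → T (b j) → j ≡ i) →
    sum (indicator ∘ b) ≈ 1#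
  sum-indicator-unique {suc n} b {i} bi unique = begin
    sum (indicator ∘ b)
      ≈⟨ sum-remove {i = i} (indicator ∘ b) ⟩
    indicator (b i) ⊕ sum (λ k → indicator (b (punchIn i k)))
      ≈⟨ +-cong (reflexive (indicator-true bi))
                (sum-zero λ k → reflexive (indicator-false λ bk → punchInᵢ≢i i k (unique _ bk))) ⟩
    1# ⊕ 0#
      ≈⟨ ⊕-identityʳ 1# ⟩
    1# ∎

  sum-one-except-two : ∀ {n} (f : Fin n → Carrier) {a b} → a ≢ b → (∀ i → i ≢ a → i ≢ b → f i ≈ 1#) →
    sum f ≈ f a ⊕ (f b ⊕ natR R (n ∸ 2))
  sum-one-except-two {suc zero}    f {zero} {zero} a≢b _ = contradiction refl a≢b
  sum-one-except-two {suc (suc n)} f {a}    {b}    a≢b f≈1 = begin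
    sum f
      ≈⟨ sum-remove {i = a} f ⟩
    f a ⊕ sum (f ∘ punchIn a)
      ≈⟨ +-congˡ (sum-remove {i = b′} (f ∘ punchIn a)) ⟩
    f a ⊕ (f (punchIn a b′) ⊕ sum (f ∘ punchIn a ∘ punchIn b′))
      ≈⟨ +-congˡ (+-cong (reflexive (cong f (punchIn-punchOut a≢b))) (sum-one λ k → f≈1 _ (punchInᵢ≢i a _) (b≢ k))) ⟩
    f a ⊕ (f b ⊕ natR R n) ∎
    where
    b′ = punchOut a≢b
    b≢ : ∀ k → punchIn a (punchIn b′ k) ≢ b
    b≢ k eq = punchInᵢ≢i b′ k (punchIn-injective a _ _ (trans eq (sym (punchIn-punchOut a≢b))))

  sumTuples : ℕ → ℕ → (List ℕ → Carrier) → Carrier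
  sumTuples zero    M F = F []
  sumTuples (suc k) M F = ∑[ i < M ] sumTuples k M (λ xs → F (suc (toℕ i) ∷ xs))

  sumTuples-cong : ∀ k M {F G : List ℕ → Carrier} →
    (∀ xs → length xs ≡ k → All (InRange M) xs → F xs ≈ G xs) → sumTuples k M F ≈ sumTuples k M G
  sumTuples-cong zero    M F≈G = F≈G [] refl []
  sumTuples-cong (suc k) M F≈G = sum-cong-≋ λ i → sumTuples-cong k M λ xs len range →
    F≈G _ (cong suc len) ((s≤s z≤n , toℕ<n i) ∷ range)

  sumTuples-zero : ∀ k M {F : List ℕ → Carrier} →
    (∀ xs → length xs ≡ k → All (InRange M) xs → F xs ≈ 0#) → sumTuples k M F ≈ 0#
  sumTuples-zero zero    M F≈0 = F≈0 [] refl []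
  sumTuples-zero (suc k) M F≈0 = sum-zero λ i → sumTuples-zero k M λ xs len range →
    F≈0 _ (cong suc len) ((s≤s z≤n , toℕ<n i) ∷ range)

  sumTuples-*ˡ : ∀ k M a (F : List ℕ → Carrier) → sumTuples k M (λ xs → a ⊗ F xs) ≈ a ⊗ sumTuples k M F
  sumTuples-*ˡ zero    M a F = ≈-refl
  sumTuples-*ˡ (suc k) M a F = begin
    ∑[ i < M ] sumTuples k M (λ xs → a ⊗ F (suc (toℕ i) ∷ xs))
      ≈⟨ sum-cong-≋ {M} (λ i → sumTuples-*ˡ k M a _) ⟩
    ∑[ i < M ] (a ⊗ G i)
      ≈⟨ *-distribˡ-sum {M} a G ⟨
    a ⊗ ∑[ i < M ] G i ∎
    where
    G : Fin M → Carrier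
    G i = sumTuples k M (λ xs → F (suc (toℕ i) ∷ xs))

  sumTuples-∑ : ∀ k M {n} (G : Fin n → List ℕ → Carrier) →
    sumTuples k M (λ xs → ∑[ c < n ] G c xs) ≈ ∑[ c < n ] sumTuples k M (G c)
  sumTuples-∑ zero    M G = ≈-refl
  sumTuples-∑ (suc k) M {n} G = begin
    ∑[ i < M ] sumTuples k M (λ xs → ∑[ c < n ] G c (suc (toℕ i) ∷ xs))
      ≈⟨ sum-cong-≋ {M} (λ i → sumTuples-∑ k M (λ c xs → G c (suc (toℕ i) ∷ xs))) ⟩
    ∑[ i < M ] ∑[ c < n ] H i c
      ≈⟨ ∑-comm {M} {n} H ⟩
    ∑[ c < n ] ∑[ i < M ] H i c ∎
    where
    H : Fin M → Fin n → Carrier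
    H i c = sumTuples k M (λ xs → G c (suc (toℕ i) ∷ xs))

  sumTuples-restrict : ∀ k M (F : List ℕ → Carrier) →
    (∀ xs → length xs ≡ k → All (InRange (suc M)) xs → ¬ All (InRange M) xs → F xs ≈ 0#) →
    sumTuples k (suc M) F ≈ sumTuples k M F
  sumTuples-restrict zero    M F F≈0 = ≈-refl
  sumTuples-restrict (suc k) M F F≈0 = begin
    ∑[ i < suc M ] G (toℕ i)                              ≈⟨ sum-init-last (G ∘ toℕ) ⟩
    ∑[ i < M ] G (toℕ (inject₁ i)) ⊕ G (toℕ (fromℕ M))    ≈⟨ +-cong (sum-cong-≋ {M} init) last ⟩
    ∑[ i < M ] sumTuples k M (λ xs → F (suc (toℕ i) ∷ xs)) ⊕ 0#
                                                          ≈⟨ ⊕-identityʳ _ ⟩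
    ∑[ i < M ] sumTuples k M (λ xs → F (suc (toℕ i) ∷ xs)) ∎
    where
    G : ℕ → Carrier
    G v = sumTuples k (suc M) (λ xs → F (suc v ∷ xs))
    init : ∀ i → G (toℕ (inject₁ i)) ≈ sumTuples k M (λ xs → F (suc (toℕ i) ∷ xs))
    init i rewrite toℕ-inject₁ i = sumTuples-restrict k M _ λ xs len range ¬range →
      F≈0 _ (cong suc len) ((s≤s z≤n , m≤n⇒m≤1+n (toℕ<n i)) ∷ range) (¬range ∘ All.tail)
    last : G (toℕ (fromℕ M)) ≈ 0#
    last rewrite toℕ-fromℕ M = sumTuples-zero k (suc M) λ xs len range →
      F≈0 _ (cong suc len) ((s≤s z≤n , ≤-refl) ∷ range) λ { ((_ , M+1≤M) ∷ _) → 1+n≰n M+1≤M }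

  sumR-++ : ∀ xs ys → sumR R (xs ++ ys) ≈ sumR R xs ⊕ sumR R ys
  sumR-++ []       ys = ≈-sym (⊕-identityˡ _)
  sumR-++ (x ∷ xs) ys = ≈-trans (+-congˡ (sumR-++ xs ys)) (≈-sym (⊕-assoc _ _ _))

  sumR-applyUpTo : ∀ M (g : ℕ → Carrier) → sumR R (applyUpTo g M) ≡ ∑[ i < M ] g (toℕ i)
  sumR-applyUpTo zero    g = refl
  sumR-applyUpTo (suc M) g = cong (g 0 ⊕_) (sumR-applyUpTo M (g ∘ suc))

  sumR-tuples : ∀ k M (F : List ℕ → Carrier) → sumR R (map F (tuples k M)) ≈ sumTuples k M F
  sumR-tuples zero    M F = ⊕-identityʳ _
  sumR-tuples (suc k) M F = begin
    sumR R (map F (concatMap (λ v → map (v ∷_) (tuples k M)) (map suc (upTo M))))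
      ≡⟨ cong (sumR R) (map-concatMap F _ (map suc (upTo M))) ⟩
    sumR R (concatMap (λ v → map F (map (v ∷_) (tuples k M))) (map suc (upTo M)))
      ≈⟨ sumR-concatMap (map suc (upTo M)) ⟩
    sumR R (map (λ v → sumR R (map F (map (v ∷_) (tuples k M)))) (map suc (upTo M)))
      ≡⟨ cong (sumR R) (trans (sym (map-∘ (upTo M))) (map-upTo _ M)) ⟩
    sumR R (applyUpTo (λ i → sumR R (map F (map (suc i ∷_) (tuples k M)))) M)
      ≡⟨ sumR-applyUpTo M _ ⟩
    ∑[ i < M ] sumR R (map F (map (λ xs → suc (toℕ i) ∷ xs) (tuples k M)))
      ≈⟨ sum-cong-≋ {M} row ⟩
    ∑[ i < M ] sumTuples k M (λ xs → F (suc (toℕ i) ∷ xs)) ∎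
    where
    row : ∀ (i : Fin M) →
      sumR R (map F (map (suc (toℕ i) ∷_) (tuples k M))) ≈ sumTuples k M (λ xs → F (suc (toℕ i) ∷ xs))
    row i = ≈-trans (reflexive (cong (sumR R) (sym (map-∘ (tuples k M))))) (sumR-tuples k M _)
    sumR-concatMap : ∀ {A : Set} {g : A → List Carrier} xs → sumR R (concatMap g xs) ≈ sumR R (map (sumR R ∘ g) xs)
    sumR-concatMap []       = ≈-refl
    sumR-concatMap {g = g} (x ∷ xs) = ≈-trans (sumR-++ (g x) (concatMap g xs)) (+-congˡ (sumR-concatMap xs))

  sumR-filter : ∀ (P : List ℕ → Bool) (w : List ℕ → Carrier) L →
    sumR R (map w (filter (λ xs → T? (P xs)) L)) ≈ sumR R (map (λ xs → indicator (P xs) ⊗ w xs) L)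
  sumR-filter P w []      = ≈-refl
  sumR-filter P w (x ∷ L) with P x
  ... | true  = +-cong (≈-sym (⊗-identityˡ _)) (sumR-filter P w L)
  ... | false = ≈-trans (sumR-filter P w L) (≈-sym (≈-trans (+-cong (zeroˡ _) ≈-refl) (⊕-identityˡ _)))

  sumTuples-chain : ∀ M (W : List ℕ → Carrier) (ω : ℕ → ℕ → Carrier) S →
    (∀ a → W (a ∷ []) ≈ 1#) →
    (∀ a v xs → W (a ∷ v ∷ xs) ≈ ω a v ⊗ W (v ∷ xs)) →
    (∀ a → InRange M a → ∑[ i < M ] ω a (suc (toℕ i)) ≈ S) →
    ∀ k a → InRange M a → sumTuples k M (λ xs → W (a ∷ xs)) ≈ powR R S k
  sumTuples-chain M W ω S W-single W-cons rowSum zero    a _ = W-single a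
  sumTuples-chain M W ω S W-single W-cons rowSum (suc k) a a∈ = begin
    ∑[ i < M ] sumTuples k M (λ xs → W (a ∷ suc (toℕ i) ∷ xs))
      ≈⟨ sum-cong-≋ {M} (λ i → sumTuples-cong k M λ xs _ _ → W-cons a (suc (toℕ i)) xs) ⟩
    ∑[ i < M ] sumTuples k M (λ xs → ω a (suc (toℕ i)) ⊗ W (suc (toℕ i) ∷ xs))
      ≈⟨ sum-cong-≋ {M} (λ i → sumTuples-*ˡ k M (ω a (suc (toℕ i))) _) ⟩
    ∑[ i < M ] (ω a (suc (toℕ i)) ⊗ sumTuples k M (λ xs → W (suc (toℕ i) ∷ xs)))
      ≈⟨ sum-cong-≋ {M} (λ i → *-congˡ (sumTuples-chain M W ω S W-single W-cons rowSum k (suc (toℕ i))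
                                                         (s≤s z≤n , toℕ<n i))) ⟩
    ∑[ i < M ] (ω a (suc (toℕ i)) ⊗ powR R S k)
      ≈⟨ *-distribʳ-sum {M} (powR R S k) (λ i → ω a (suc (toℕ i))) ⟨
    ∑[ i < M ] ω a (suc (toℕ i)) ⊗ powR R S k
      ≈⟨ *-congʳ (rowSum a a∈) ⟩
    S ⊗ powR R S k ∎

  module _ (N-1 : ℕ) where

    open Rotation N-1

    sum-rot : ∀ (h : ℕ → Carrier) → ∑[ i < N ] h (rot (suc (toℕ i))) ≈ ∑[ i < N ] h (suc (toℕ i))
    sum-rot h = begin
      ∑[ i < N ] h (rot (suc (toℕ i)))
        ≈⟨ sum-init-last (λ i → h (rot (suc (toℕ i)))) ⟩
      ∑[ i < N-1 ] h (rot (suc (toℕ (inject₁ i)))) ⊕ h (rot (suc (toℕ (fromℕ N-1))))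
        ≈⟨ +-cong (sum-cong-≋ {N-1} λ i → reflexive (cong h (trans (cong (rot ∘ suc) (toℕ-inject₁ i))
                                                                         (rot-< (s≤s (toℕ<n i))))))
                  (reflexive (cong h (trans (cong (rot ∘ suc) (toℕ-fromℕ N-1)) rot-N))) ⟩
      ∑[ i < N-1 ] h (suc (suc (toℕ i))) ⊕ h 1
        ≈⟨ ⊕-comm _ _ ⟩
      h 1 ⊕ ∑[ i < N-1 ] h (suc (suc (toℕ i)))
        ∎

    sumTuples-map-rot : ∀ k (F : List ℕ → Carrier) → sumTuples k N (F ∘ map rot) ≈ sumTuples k N F
    sumTuples-map-rot zero    F = ≈-refl
    sumTuples-map-rot (suc k) F = begin
      ∑[ i < N ] sumTuples k N (λ xs → F (rot (suc (toℕ i)) ∷ map rot xs))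
        ≈⟨ sum-cong-≋ {N} (λ i → sumTuples-map-rot k (λ xs → F (rot (suc (toℕ i)) ∷ xs))) ⟩
      ∑[ i < N ] sumTuples k N (λ xs → F (rot (suc (toℕ i)) ∷ xs))
        ≈⟨ sum-rot (λ v → sumTuples k N (λ xs → F (v ∷ xs))) ⟩
      ∑[ i < N ] sumTuples k N (λ xs → F (suc (toℕ i) ∷ xs))
        ∎

    sumTuples-rotate : ∀ c k (F : List ℕ → Carrier) → sumTuples k N (F ∘ rotate c) ≈ sumTuples k N F
    sumTuples-rotate zero    k F = ≈-refl
    sumTuples-rotate (suc c) k F = ≈-trans (sumTuples-rotate c k (F ∘ map rot)) (sumTuples-map-rot k F)

    sumTuples-orbits : ∀ k (F : List ℕ → Carrier) →
      sumTuples (suc k) N F ≈ ∑[ c < N ] sumTuples k N (λ xs → F (rotate (toℕ c) (1 ∷ xs)))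
    sumTuples-orbits k F = sum-cong-≋ {N} λ c → ≈-sym (begin
      sumTuples k N (λ xs → F (rotate (toℕ c) (1 ∷ xs)))
        ≈⟨ sumTuples-cong k N (λ xs _ _ → reflexive (cong F (rotate-∷ (toℕ<n c) xs))) ⟩
      sumTuples k N (λ xs → F (suc (toℕ c) ∷ rotate (toℕ c) xs))
        ≈⟨ sumTuples-rotate (toℕ c) k (λ xs → F (suc (toℕ c) ∷ xs)) ⟩
      sumTuples k N (λ xs → F (suc (toℕ c) ∷ xs))
        ∎)


module WeightedSum {c r} (R : CommutativeSemiring c r) (N-1 ℓ m : ℕ) (m≢ℓ : m ≢ ℓ) (ℓ<N : ℓ < suc N-1) (m<N : m < suc N-1)
  (q t : CommutativeSemiring.Carrier R) where

  open import Data.Bool using (Bool; true; false; T; if_then_else_)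
  open import Data.Fin using (Fin; zero; suc; toℕ; fromℕ<)
  open import Data.Fin.Properties using (toℕ<n; toℕ-fromℕ<; toℕ-injective)
  open import Data.List using (List; _∷_; length; map)
  open import Data.List.Relation.Unary.All as All using (All; _∷_)
  open import Data.Nat
  open import Data.Nat.Properties
  open import Data.Product using (_,_; proj₁; proj₂)
  open import Function using (_∘_)
  open import Relation.Binary.PropositionalEquality
  open import Relation.Nullary using (¬_; contradiction)
  open import Relation.Nullary.Decidable using (dec-true; dec-false)
  open Counting
  open CommutativeSemiring R
    using (Carrier; _≈_; 0#; 1#; semiring; reflexive; +-cong; *-cong; *-congˡ; *-congʳ; zeroˡ)
    renaming (_+_ to _⊕_; _*_ to _⊗_; refl to ≈-refl; sym to ≈-sym; trans to ≈-trans; setoid to ≈-setoid;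
              +-assoc to ⊕-assoc; *-assoc to ⊗-assoc; *-identityˡ to ⊗-identityˡ; *-identityʳ to ⊗-identityʳ)
  open import Algebra.Properties.Semiring.Sum semiring using (sum-syntax; sum-cong-≗; *-distribʳ-sum)
  open import Algebra.Properties.CommutativeSemigroup (CommutativeSemiring.*-commutativeSemigroup R) using (interchange)
  open import Relation.Binary.Reasoning.Setoid ≈-setoid
  open Sums R
  open Rotation N-1

  bit : Bool → ℕ
  bit b = if b then 1 else 0

  W : List ℕ → Carrier
  W xs = powR R q (forwardDiffCount N ℓ xs) ⊗ powR R t (forwardDiffCount N m xs)

  ω : ℕ → ℕ → Carrier
  ω a v = powR R q (bit (congMod N v (a + ℓ))) ⊗ powR R t (bit (congMod N v (a + m)))

  S : Carrier
  S = q ⊕ t ⊕ natR R (N ∸ 2)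

  powR-+ : ∀ x i j → powR R x (i + j) ≈ powR R x i ⊗ powR R x j
  powR-+ x zero    j = ≈-sym (⊗-identityˡ _)
  powR-+ x (suc i) j = ≈-trans (*-congˡ (powR-+ x i j)) (≈-sym (⊗-assoc _ _ _))

  W-∷ : ∀ a v xs → W (a ∷ v ∷ xs) ≈ ω a v ⊗ W (v ∷ xs)
  W-∷ a v xs = ≈-trans (*-cong (powR-+ q (bit (congMod N v (a + ℓ))) (forwardDiffCount N ℓ (v ∷ xs)))
                               (powR-+ t (bit (congMod N v (a + m))) (forwardDiffCount N m (v ∷ xs))))
                      (interchange _ _ _ _)

  W-rotate : ∀ c xs → W (rotate c xs) ≡ W xs
  W-rotate c xs =
    cong₂ (λ i j → powR R q i ⊗ powR R t j) (forwardDiffCount-rotate ℓ c xs) (forwardDiffCount-rotate m c xs)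

  ω-rot : ∀ a v → ω (rot a) (rot v) ≡ ω a v
  ω-rot a v = cong₂ (λ b b′ → powR R q (bit b) ⊗ powR R t (bit b′)) (congMod-rot a v ℓ) (congMod-rot a v m)

  ω-1 : ∀ {i} → i < N → ω 1 (suc i) ≡ powR R q (bit (i ≡ᵇ ℓ)) ⊗ powR R t (bit (i ≡ᵇ m))
  ω-1 i<N = cong₂ (λ b b′ → powR R q (bit b) ⊗ powR R t (bit b′))
    (trans (congMod-suc _ ℓ) (congMod-< i<N ℓ<N)) (trans (congMod-suc _ m) (congMod-< i<N m<N))

  rowSum-1 : ∑[ i < N ] ω 1 (suc (toℕ i)) ≈ S
  rowSum-1 = begin
    ∑[ i < N ] ω 1 (suc (toℕ i))         ≈⟨ sum-one-except-two (λ i → ω 1 (suc (toℕ i))) a≢b other ⟩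
    ω 1 (suc (toℕ a)) ⊕ (ω 1 (suc (toℕ b)) ⊕ natR R (N ∸ 2))
                                         ≈⟨ +-cong at-ℓ (+-cong at-m ≈-refl) ⟩
    q ⊕ (t ⊕ natR R (N ∸ 2))             ≈⟨ ⊕-assoc q t _ ⟨
    S                                    ∎
    where
    -- The rewrites below use that does (i ≟ j) unfolds to i ≡ᵇ j.
    a b : Fin N
    a = fromℕ< ℓ<N
    b = fromℕ< m<N
    a≢b : a ≢ b
    a≢b a≡b = m≢ℓ (trans (sym (toℕ-fromℕ< m<N)) (trans (cong toℕ (sym a≡b)) (toℕ-fromℕ< ℓ<N)))
    at-ℓ : ω 1 (suc (toℕ a)) ≈ q
    at-ℓ rewrite ω-1 (toℕ<n a) | toℕ-fromℕ< ℓ<N | dec-true (ℓ ≟ ℓ) refl | dec-false (ℓ ≟ m) (m≢ℓ ∘ sym) =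
      ≈-trans (⊗-identityʳ _) (⊗-identityʳ q)
    at-m : ω 1 (suc (toℕ b)) ≈ t
    at-m rewrite ω-1 (toℕ<n b) | toℕ-fromℕ< m<N | dec-true (m ≟ m) refl | dec-false (m ≟ ℓ) m≢ℓ =
      ≈-trans (⊗-identityˡ _) (⊗-identityʳ t)
    other : ∀ i → i ≢ a → i ≢ b → ω 1 (suc (toℕ i)) ≈ 1#
    other i i≢a i≢b rewrite ω-1 (toℕ<n i)
      | dec-false (toℕ i ≟ ℓ) (λ i≡ℓ → i≢a (toℕ-injective (trans i≡ℓ (sym (toℕ-fromℕ< ℓ<N)))))
      | dec-false (toℕ i ≟ m) (λ i≡m → i≢b (toℕ-injective (trans i≡m (sym (toℕ-fromℕ< m<N))))) = ⊗-identityˡ 1#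

  rowSum : ∀ a → InRange N a → ∑[ i < N ] ω a (suc (toℕ i)) ≈ S
  rowSum (suc zero)    _              = rowSum-1
  rowSum (suc (suc a)) (_ , a+2≤N) = begin
    ∑[ i < N ] ω (suc (suc a)) (suc (toℕ i))    ≡⟨ cong (λ b → ∑[ i < N ] ω b (suc (toℕ i))) (rot-< a+2≤N) ⟨
    ∑[ i < N ] ω (rot (suc a)) (suc (toℕ i))    ≈⟨ sum-rot N-1 (ω (rot (suc a))) ⟨
    ∑[ i < N ] ω (rot (suc a)) (rot (suc (toℕ i))) ≡⟨ sum-cong-≗ {N} (λ i → ω-rot (suc a) (suc (toℕ i))) ⟩
    ∑[ i < N ] ω (suc a) (suc (toℕ i))          ≈⟨ rowSum (suc a) (s≤s z≤n , <⇒≤ a+2≤N) ⟩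
    S                                           ∎

  F : List ℕ → Carrier
  F xs = indicator (isPrimeParking xs) ⊗ W xs

  orbit-sum : ∀ ys → length ys ≡ N → All (InRange N) ys → ∑[ c < N ] F (rotate (toℕ c) (1 ∷ ys)) ≈ W (1 ∷ ys)
  orbit-sum ys len range = begin
    ∑[ c < N ] (indicator (prime c) ⊗ W (rotate (toℕ c) zs))
      ≡⟨ sum-cong-≗ {N} (λ c → cong (indicator (prime c) ⊗_) (W-rotate (toℕ c) zs)) ⟩
    ∑[ c < N ] (indicator (prime c) ⊗ W zs)
      ≈⟨ *-distribʳ-sum {N} (W zs) (indicator ∘ prime) ⟨
    ∑[ c < N ] indicator (prime c) ⊗ W zs
      ≈⟨ *-congʳ (sum-indicator-unique prime c₀-prime unique) ⟩
    1# ⊗ W zs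
      ≈⟨ ⊗-identityˡ _ ⟩
    W zs ∎
    where
    zs = 1 ∷ ys
    open Orbit N-1 zs ((s≤s z≤n , s≤s z≤n) ∷ range) (cong suc len)
    prime : Fin N → Bool
    prime c = isPrimeParking (rotate (toℕ c) zs)
    c₀<N = proj₁ (proj₂ primeRotation-exists)
    rotation-c₀-prime = proj₂ (proj₂ primeRotation-exists)
    c₀-prime : T (prime (fromℕ< c₀<N))
    c₀-prime = subst (λ c → T (isPrimeParking (rotate c zs))) (sym (toℕ-fromℕ< c₀<N)) rotation-c₀-prime
    unique : ∀ c → T (prime c) → c ≡ fromℕ< c₀<N
    unique c c-prime = toℕ-injective (trans (primeRotation-unique (toℕ<n c) c₀<N c-prime rotation-c₀-prime)
                                            (sym (toℕ-fromℕ< c₀<N)))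

  F-vanishes : ∀ xs → length xs ≡ suc N → All (InRange (suc N)) xs → ¬ All (InRange N) xs → F xs ≈ 0#
  F-vanishes xs len range ¬range with isPrimeParking xs in prime≡
  ... | false = zeroˡ (W xs)
  ... | true  = contradiction (All.zipWith (λ (r , ≤N) → proj₁ r , ≤N)
                  (range , isPrimeParking⇒All≤ N xs (s≤s z≤n) len (subst T (sym prime≡) _))) ¬range

  PPF-sum : sumR R (map W (PPF (suc N))) ≈ powR R S N
  PPF-sum = begin
    sumR R (map W (PPF (suc N)))
      ≈⟨ sumR-filter isPrimeParking W (tuples (suc N) (suc N)) ⟩
    sumR R (map F (tuples (suc N) (suc N)))
      ≈⟨ sumR-tuples (suc N) (suc N) F ⟩
    sumTuples (suc N) (suc N) F
      ≈⟨ sumTuples-restrict (suc N) N F F-vanishes ⟩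
    sumTuples (suc N) N F
      ≈⟨ sumTuples-orbits N-1 N F ⟩
    ∑[ c < N ] sumTuples N N (λ ys → F (rotate (toℕ c) (1 ∷ ys)))
      ≈⟨ sumTuples-∑ N N {N} (λ c ys → F (rotate (toℕ c) (1 ∷ ys))) ⟨
    sumTuples N N (λ ys → ∑[ c < N ] F (rotate (toℕ c) (1 ∷ ys)))
      ≈⟨ sumTuples-cong N N orbit-sum ⟩
    sumTuples N N (λ ys → W (1 ∷ ys))
      ≈⟨ sumTuples-chain N W ω S (λ _ → ⊗-identityˡ 1#) W-∷ rowSum N 1 (≤-refl , s≤s z≤n) ⟩
    powR R S N ∎


proposition6p4 : ∀ {c r} (R : CommutativeSemiring c r) (n ℓ m : ℕ) →
    m ≢ ℓ → m ≤ n ∸ 2 → ℓ ≤ n ∸ 2 →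
    let open CommutativeSemiring R
    in ∀ (q t : Carrier) →
      sumR R (map (λ π → powR R q (Δf n ℓ π) * powR R t (Δf n m π)) (PPF n))
        ≈ powR R (q + t + natR R (n ∸ 3)) (n ∸ 1)
proposition6p4 R zero             ℓ m m≢ℓ z≤n z≤n = ⊥-elim (m≢ℓ refl)
proposition6p4 R (suc zero)       ℓ m m≢ℓ z≤n z≤n = ⊥-elim (m≢ℓ refl)
proposition6p4 R (suc (suc N-1)) ℓ m m≢ℓ m≤N-1 ℓ≤N-1 q t =
  WeightedSum.PPF-sum R N-1 ℓ m m≢ℓ (s≤s ℓ≤N-1) (s≤s m≤N-1) q t
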